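{- Let $n\ge1$, $\varphi\in S_n$, $G=G_\varphi(n)$, and $U\subseteq V(G)$. Then $\frac{e_G(U)}{49}\le\mu_G(U)\le e_G(U)+1$.
   Context: A $b$-ary tree is a rooted tree in which every vertex has at most $b$ children; the level of a vertex is its distance to the root, and level $\ell$ is filled if it contains $b^\ell$ vertices; $n_x$ is the number of vertices in the subtree rooted at $x$. A $b$-ary tree is balanced if every non-empty level except possibly the last non-empty one is filled, and $|n_x-n_y|\le1$ for any two vertices $x,y$ on the same level. For $b\in\{2,3\}$, $T_b(n)$ denotes a fixed balanced $b$-ary tree with vertex set $[n]$. $G_\varphi(n)$ is the graph on $[n]$ with edge set $\{\{\varphi(i),\varphi(j)\}:\{i,j\}\in E(T_2(n))\}\cup E(T_3(n))$. For $U\subseteq V(G)$, $e_G(U)$ is the number of edges of $G$ with one endpoint in $U$ and the other in $V(G)\setminus U$. Two vertices $x,y\in U$ are $U$-similar if their sets of neighbours in $V(G)\setminus U$ coincide; this is an equivalence relation on $U$ and $\mu_G(U)$ is its number of equivalence classes. -}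

module Defs where

open import Data.Nat as ℕ using (ℕ; zero; suc; _∸_; _^_)
open import Data.Fin using (Fin) renaming (_<_ to _<ᶠ_)
open import Data.Fin.Properties using (_≟_; all?) renaming (_<?_ to _<ᶠ?_)
open import Data.Fin.Subset using (Subset; _∈_; _∉_)
open import Data.Fin.Subset.Properties using (_∈?_)
open import Data.Fin.Permutation using (Permutation′; _⟨$⟩ˡ_)
open import Data.List using (List; length; filter; allFin; map)
open import Data.Nat.ListAction using (sum)
import Level
open import Data.Product using (_×_; _,_)
open import Data.Sum using (_⊎_)
open import Relation.Nullary using (¬_; Dec; ¬?)
open import Relation.Nullary.Decidable using (_×-dec_; _⊎-dec_; _→-dec_)
open import Relation.Unary using (Pred; Decidable)
open import Relation.Binary.PropositionalEquality using (_≡_; _≢_)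

count : ∀ {n} {P : Pred (Fin n) Level.zero} → Decidable P → ℕ
count {n} P? = length (filter P? (allFin n))

iter : ∀ {A : Set} → (A → A) → ℕ → A → A
iter f zero    a = a
iter f (suc k) a = f (iter f k a)

-- A rooted tree on vertex set Fin n, given by its root, a parent map
-- (the value at the root is irrelevant) and the level (depth) function,
-- which forces acyclicity: every non-root vertex is one level below its parent.
record RootedTree (n : ℕ) : Set where
  field
    root        : Fin n
    parent      : Fin n → Fin n
    depth       : Fin n → ℕ
    depth-root  : depth root ≡ 0
    depth-child : ∀ x → x ≢ root → depth x ≡ suc (depth (parent x))

module _ {n : ℕ} (T : RootedTree n) where
  open RootedTree T

  IsChild : Fin n → Fin n → Set
  IsChild x y = y ≢ root × parent y ≡ x

  isChild? : ∀ x → Decidable (IsChild x)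
  isChild? x y = ¬? (y ≟ root) ×-dec (parent y ≟ x)

  numChildren : Fin n → ℕ
  numChildren x = count (isChild? x)

  levelSize : ℕ → ℕ
  levelSize ℓ = count (λ y → depth y ℕ.≟ ℓ)

  -- y lies in the subtree rooted at x (x is an ancestor of y, or x = y):
  -- going up (depth y ∸ depth x) steps from y reaches x
  InSubtree : Fin n → Fin n → Set
  InSubtree x y = iter parent (depth y ∸ depth x) y ≡ x

  subtreeSize : Fin n → ℕ
  subtreeSize x = count (λ y → iter parent (depth y ∸ depth x) y ≟ x)

  TreeEdge : Fin n → Fin n → Set
  TreeEdge i j = IsChild j i ⊎ IsChild i j

  treeEdge? : ∀ i j → Dec (TreeEdge i j)
  treeEdge? i j = isChild? j i ⊎-dec isChild? i j

record IsBalanced (b : ℕ) {n : ℕ} (T : RootedTree n) : Set where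
  open RootedTree T
  field
    b-ary    : ∀ x → numChildren T x ℕ.≤ b
    -- every non-empty level except the last non-empty one is filled:
    -- if some vertex lies strictly below level ℓ, level ℓ is filled
    filled   : ∀ ℓ x → ℓ ℕ.< depth x → levelSize T ℓ ≡ b ^ ℓ
    sizes    : ∀ x y → depth x ≡ depth y → subtreeSize T x ℕ.≤ suc (subtreeSize T y)

-- The graph G_φ(n): {x,y} is an edge iff {φ⁻¹ x, φ⁻¹ y} ∈ E(T₂) or {x,y} ∈ E(T₃)
module Graph {n : ℕ} (T₂ T₃ : RootedTree n) (φ : Permutation′ n) where

  Adj : Fin n → Fin n → Set
  Adj x y = TreeEdge T₂ (φ ⟨$⟩ˡ x) (φ ⟨$⟩ˡ y) ⊎ TreeEdge T₃ x y

  adj? : ∀ x y → Dec (Adj x y)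
  adj? x y = treeEdge? T₂ (φ ⟨$⟩ˡ x) (φ ⟨$⟩ˡ y) ⊎-dec treeEdge? T₃ x y

  -- e_G(U): number of edges with one end in U and the other outside U,
  -- counted as ordered pairs (x , y) with x ∈ U, y ∉ U (each such edge once)
  eG : Subset n → ℕ
  eG U = sum (map (λ x → count (λ y → (x ∈? U) ×-dec ¬? (y ∈? U) ×-dec adj? x y)) (allFin n))

  Similar : Subset n → Fin n → Fin n → Set
  Similar U x y = ∀ z → z ∉ U → (Adj x z → Adj y z) × (Adj y z → Adj x z)

  similar? : ∀ U x y → Dec (Similar U x y)
  similar? U x y = all? (λ z → ¬? (z ∈? U) →-dec ((adj? x z →-dec adj? y z) ×-dec (adj? y z →-dec adj? x z)))

  -- μ_G(U): number of U-similarity classes, counted via their least elements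
  -- (x ∈ U such that no y ∈ U with y < x is U-similar to x)
  μG : Subset n → ℕ
  μG U = count (λ x → (x ∈? U) ×-dec
           all? (λ y → (y ∈? U) →-dec (y <ᶠ? x) →-dec ¬? (similar? U x y)))

-- Only the degree bound Δ = 7 of G matters: a vertex has its parent and at most two children
-- in T₂, and its parent and at most three children in T₃. A U-similarity class containing a
-- vertex adjacent to some z ∉ U lies in the neighbourhood of z, so it has at most Δ elements,
-- each incident to at most Δ crossing edges; hence e(U) ≤ Δ² μ(U). Conversely, every class except
-- possibly the single one without outside neighbours contains an endpoint of a crossing edge,
-- so μ(U) ≤ e(U) + 1.
module Submission where

open import Defs
open import Data.Nat using (ℕ; zero; suc; _≤_; _*_; _+_; z≤n)
open import Data.Nat.Properties
  using (≤-reflexive; ≤-trans; +-mono-≤; *-monoʳ-≤; m≤m+n; m≤n+m; *-identityʳ; *-assoc; +-*-semiring; module ≤-Reasoning)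
import Data.Nat.ListAction as ListAction
open import Data.Fin as Fin using (Fin) renaming (_<_ to _<ᶠ_)
open import Data.Fin.Properties using (all?; any?; <-cmp; suc-injective) renaming (_<?_ to _<ᶠ?_)
open import Data.Fin.Induction using (<-wellFounded)
open import Data.Fin.Subset using (Subset; _∈_; _∉_)
open import Data.Fin.Subset.Properties using (_∈?_)
open import Data.Fin.Permutation using (Permutation′; _⟨$⟩ˡ_; flip)
open import Data.List as List using (length; filter; tabulate; allFin)
open import Data.Bool using (true; false)
open import Data.Product using (_×_; _,_; ∃; proj₁; proj₂)
open import Data.Sum as Sum using (_⊎_; inj₁; inj₂)
open import Data.Empty using (⊥-elim)
open import Function using (id; _∘_)
open import Induction.WellFounded using (Acc; acc)
open import Relation.Binary using (tri<; tri≈; tri>)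
open import Relation.Binary.PropositionalEquality using (_≡_; _≢_; refl; sym; trans; cong)
open import Relation.Nullary using (¬_; Dec; yes; no; _because_; ¬?)
open import Relation.Nullary.Decidable using (_×-dec_; _→-dec_)
open import Relation.Unary using (Pred; Decidable)
open import Algebra.Properties.Semiring.Sum +-*-semiring
  using (sum; sum-syntax; sum-cong-≗; sum-replicate-zero; ∑-distrib-+; ∑-comm; ∑-permute; *-distribˡ-sum)
open import Level using (0ℓ)

private variable
  n k : ℕ
  A B C : Set

𝟙 : Dec A → ℕ
𝟙 (true  because _) = 1
𝟙 (false because _) = 0

𝟙-yes : (a : Dec A) → A → 𝟙 a ≡ 1
𝟙-yes (yes _) _ = refl
𝟙-yes (no ¬a) a = ⊥-elim (¬a a)

𝟙-no : (a : Dec A) → ¬ A → 𝟙 a ≡ 0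
𝟙-no (yes a) ¬a = ⊥-elim (¬a a)
𝟙-no (no _)  _  = refl

𝟙-mono : (a : Dec A) (b : Dec B) → (A → B) → 𝟙 a ≤ 𝟙 b
𝟙-mono (yes a) b f = ≤-reflexive (sym (𝟙-yes b (f a)))
𝟙-mono (no _)  b f = z≤n

𝟙-⊎ : (c : Dec C) (a : Dec A) (b : Dec B) → (C → A ⊎ B) → 𝟙 c ≤ 𝟙 a + 𝟙 b
𝟙-⊎ (no _)  a b f = z≤n
𝟙-⊎ (yes c) a b f with f c
... | inj₁ x = ≤-trans (≤-reflexive (sym (𝟙-yes a x))) (m≤m+n _ _)
... | inj₂ y = ≤-trans (≤-reflexive (sym (𝟙-yes b y))) (m≤n+m _ _)

𝟙-split : (a : Dec A) (b : Dec B) → 𝟙 a ≡ 𝟙 (a ×-dec b) + 𝟙 (a ×-dec ¬? b)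
𝟙-split (yes _) (yes _) = refl
𝟙-split (yes _) (no _)  = refl
𝟙-split (no _)  _       = refl

sum-mono-≤ : {f g : Fin n → ℕ} → (∀ i → f i ≤ g i) → sum f ≤ sum g
sum-mono-≤ {zero}  f≤g = z≤n
sum-mono-≤ {suc n} f≤g = +-mono-≤ (f≤g Fin.zero) (sum-mono-≤ (f≤g ∘ Fin.suc))

sum-≡0 : (f : Fin n → ℕ) → (∀ i → f i ≡ 0) → sum f ≡ 0
sum-≡0 {n} f f≡0 = trans (sum-cong-≗ f≡0) (sum-replicate-zero n)

≤-sum : (f : Fin n → ℕ) (i : Fin n) → f i ≤ sum f
≤-sum f Fin.zero    = m≤m+n _ _
≤-sum f (Fin.suc i) = ≤-trans (≤-sum (f ∘ Fin.suc) i) (m≤n+m _ _)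

count≡∑𝟙 : {P : Pred (Fin n) 0ℓ} (P? : Decidable P) → count P? ≡ ∑[ i < n ] 𝟙 (P? i)
count≡∑𝟙 {n} P? = go n id
  where
  go : ∀ m (f : Fin m → Fin n) → length (filter P? (tabulate f)) ≡ ∑[ i < m ] 𝟙 (P? (f i))
  go zero    f = refl
  go (suc m) f with P? (f Fin.zero)
  ... | yes _ = cong suc (go m (f ∘ Fin.suc))
  ... | no _  = go m (f ∘ Fin.suc)

sum-map-allFin : (g : Fin n → ℕ) → ListAction.sum (List.map g (allFin n)) ≡ ∑[ i < n ] g i
sum-map-allFin {n} g = go n id
  where
  go : ∀ m (f : Fin m → Fin n) → ListAction.sum (List.map g (tabulate f)) ≡ ∑[ i < m ] g (f i)
  go zero    f = refl
  go (suc m) f = cong (g (f Fin.zero) +_) (go m (f ∘ Fin.suc))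

∑𝟙-unique : {P : Pred (Fin n) 0ℓ} (P? : Decidable P) →
            (∀ i j → P i → P j → i ≡ j) → ∑[ i < n ] 𝟙 (P? i) ≤ 1
∑𝟙-unique {zero}  P? unique = z≤n
∑𝟙-unique {suc n} P? unique with P? Fin.zero
... | yes p₀ = ≤-reflexive (cong suc (sum-≡0 _ λ i → 𝟙-no (P? (Fin.suc i)) (λ p → 0≢suc (unique _ _ p₀ p))))
  where
  0≢suc : ∀ {i : Fin n} → Fin.zero ≢ Fin.suc i
  0≢suc ()
... | no _   = ∑𝟙-unique (P? ∘ Fin.suc) (λ i j p q → suc-injective (unique _ _ p q))

𝟙≤∑𝟙 : {P : Pred (Fin n) 0ℓ} (a : Dec A) (P? : Decidable P) →
       (A → ∃ P) → 𝟙 a ≤ ∑[ i < n ] 𝟙 (P? i)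
𝟙≤∑𝟙 (no _)  P? witness = z≤n
𝟙≤∑𝟙 (yes a) P? witness with i , p ← witness a =
  ≤-trans (≤-reflexive (sym (𝟙-yes (P? i) p))) (≤-sum (λ i → 𝟙 (P? i)) i)

∑𝟙≤*𝟙 : {P : Pred (Fin n) 0ℓ} (P? : Decidable P) (a : Dec A) →
        (∀ i → P i → A) → (∀ i → P i → ∑[ j < n ] 𝟙 (P? j) ≤ k) →
        ∑[ i < n ] 𝟙 (P? i) ≤ k * 𝟙 a
∑𝟙≤*𝟙 P? (no ¬a) P⇒A bound = ≤-trans (≤-reflexive (sum-≡0 _ λ i → 𝟙-no (P? i) (¬a ∘ P⇒A i))) z≤n
∑𝟙≤*𝟙 {k = k} P? (yes _) P⇒A bound with any? P?
... | yes (i , p) = ≤-trans (bound i p) (≤-reflexive (sym (*-identityʳ k)))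
... | no ∄P       = ≤-trans (≤-reflexive (sum-≡0 _ λ i → 𝟙-no (P? i) (λ p → ∄P (i , p)))) z≤n

tree-degree : ∀ {b} (T : RootedTree n) → (∀ x → numChildren T x ≤ b) →
              ∀ x → ∑[ y < n ] 𝟙 (treeEdge? T x y) ≤ suc b
tree-degree {n} {b} T b-ary x = begin
  ∑[ y < n ] 𝟙 (treeEdge? T x y)
    ≤⟨ sum-mono-≤ (λ y → 𝟙-⊎ (treeEdge? T x y) (isChild? T y x) (isChild? T x y) id) ⟩
  ∑[ y < n ] (𝟙 (isChild? T y x) + 𝟙 (isChild? T x y))
    ≡⟨ ∑-distrib-+ (λ y → 𝟙 (isChild? T y x)) (λ y → 𝟙 (isChild? T x y)) ⟩
  ∑[ y < n ] 𝟙 (isChild? T y x) + ∑[ y < n ] 𝟙 (isChild? T x y)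
    ≤⟨ +-mono-≤ (∑𝟙-unique (λ y → isChild? T y x) (λ _ _ (_ , p≡y) (_ , p≡y′) → trans (sym p≡y) p≡y′))
                (≤-trans (≤-reflexive (sym (count≡∑𝟙 (isChild? T x)))) (b-ary x)) ⟩
  suc b ∎
  where open ≤-Reasoning

module _ {n} (T₂ T₃ : RootedTree n) (φ : Permutation′ n) where
  open Graph T₂ T₃ φ

  degree : Fin n → ℕ
  degree x = ∑[ y < n ] 𝟙 (adj? x y)

  degree-≤ : ∀ {b c} → (∀ x → numChildren T₂ x ≤ b) → (∀ x → numChildren T₃ x ≤ c) →
             ∀ x → degree x ≤ suc b + suc c
  degree-≤ {b} {c} b-ary₂ b-ary₃ x = begin
    degree x
      ≤⟨ sum-mono-≤ (λ y → 𝟙-⊎ (adj? x y) (edge₂? y) (edge₃? y) id) ⟩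
    ∑[ y < n ] (𝟙 (edge₂? y) + 𝟙 (edge₃? y))
      ≡⟨ ∑-distrib-+ (λ y → 𝟙 (edge₂? y)) (λ y → 𝟙 (edge₃? y)) ⟩
    ∑[ y < n ] 𝟙 (edge₂? y) + ∑[ y < n ] 𝟙 (edge₃? y)
      ≡⟨ cong (_+ ∑[ y < n ] 𝟙 (edge₃? y)) (sym (∑-permute (λ w → 𝟙 (treeEdge? T₂ (φ ⟨$⟩ˡ x) w)) (flip φ))) ⟩
    ∑[ w < n ] 𝟙 (treeEdge? T₂ (φ ⟨$⟩ˡ x) w) + ∑[ y < n ] 𝟙 (edge₃? y)
      ≤⟨ +-mono-≤ (tree-degree T₂ b-ary₂ (φ ⟨$⟩ˡ x)) (tree-degree T₃ b-ary₃ x) ⟩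
    suc b + suc c ∎
    where
    open ≤-Reasoning
    edge₂? : ∀ y → Dec (TreeEdge T₂ (φ ⟨$⟩ˡ x) (φ ⟨$⟩ˡ y))
    edge₂? y = treeEdge? T₂ (φ ⟨$⟩ˡ x) (φ ⟨$⟩ˡ y)
    edge₃? : ∀ y → Dec (TreeEdge T₃ x y)
    edge₃? = treeEdge? T₃ x

  adj-sym : ∀ {x y} → Adj x y → Adj y x
  adj-sym (inj₁ e) = inj₁ (Sum.swap e)
  adj-sym (inj₂ e) = inj₂ (Sum.swap e)

  module _ (U : Subset n) where

    Crossing : Fin n → Fin n → Set
    Crossing x y = x ∈ U × y ∉ U × Adj x y

    crossing? : ∀ x y → Dec (Crossing x y)
    crossing? x y = (x ∈? U) ×-dec ¬? (y ∈? U) ×-dec adj? x y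

    OnBoundary : Fin n → Set
    OnBoundary x = ∃ (Crossing x)

    onBoundary? : ∀ x → Dec (OnBoundary x)
    onBoundary? x = any? (crossing? x)

    Representative : Fin n → Set
    Representative r = r ∈ U × (∀ y → y ∈ U → y <ᶠ r → ¬ Similar U r y)

    representative? : ∀ r → Dec (Representative r)
    representative? r = (r ∈? U) ×-dec all? (λ y → (y ∈? U) →-dec (y <ᶠ? r) →-dec ¬? (similar? U r y))

    eG≡∑∑𝟙 : eG U ≡ ∑[ x < n ] ∑[ y < n ] 𝟙 (crossing? x y)
    eG≡∑∑𝟙 = trans (sum-map-allFin (λ x → count (crossing? x))) (sum-cong-≗ (λ x → count≡∑𝟙 (crossing? x)))

    μG≡∑𝟙 : μG U ≡ ∑[ r < n ] 𝟙 (representative? r)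
    μG≡∑𝟙 = count≡∑𝟙 representative?

    similar-refl : ∀ {x} → Similar U x x
    similar-refl z z∉U = id , id

    similar-sym : ∀ {x y} → Similar U x y → Similar U y x
    similar-sym x~y z z∉U = proj₂ (x~y z z∉U) , proj₁ (x~y z z∉U)

    similar-trans : ∀ {x y w} → Similar U x y → Similar U y w → Similar U x w
    similar-trans x~y y~w z z∉U =
      proj₁ (y~w z z∉U) ∘ proj₁ (x~y z z∉U) , proj₂ (x~y z z∉U) ∘ proj₂ (y~w z z∉U)

    representative-of : ∀ x → x ∈ U → ∃ λ r → Representative r × Similar U r x
    representative-of x = go x (<-wellFounded x)
      where
      go : ∀ x → Acc _<ᶠ_ x → x ∈ U → ∃ λ r → Representative r × Similar U r x
      go x (acc below) x∈U with any? (λ y → (y ∈? U) ×-dec (y <ᶠ? x) ×-dec similar? U x y)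
      ... | no ∄y = x , (x∈U , λ y y∈U y<x x~y → ∄y (y , y∈U , y<x , x~y)) , similar-refl
      ... | yes (y , y∈U , y<x , x~y) with r , rep , r~y ← go y (below y<x) y∈U =
        r , rep , similar-trans r~y (similar-sym x~y)

    representative-unique : ∀ {r r′} → Representative r → Representative r′ → Similar U r r′ → r ≡ r′
    representative-unique {r} {r′} (r∈U , least) (r′∈U , least′) r~r′ with <-cmp r r′
    ... | tri< r<r′ _ _ = ⊥-elim (least′ r r∈U r<r′ (similar-sym r~r′))
    ... | tri≈ _ r≡r′ _ = r≡r′
    ... | tri> _ _ r′<r = ⊥-elim (least r′ r′∈U r′<r r~r′)

    interior-similar : ∀ {x y} → x ∈ U → y ∈ U → ¬ OnBoundary x → ¬ OnBoundary y → Similar U x y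
    interior-similar x∈U y∈U x-interior y-interior z z∉U =
      (λ x-z → ⊥-elim (x-interior (z , x∈U , z∉U , x-z))) ,
      (λ y-z → ⊥-elim (y-interior (z , y∈U , z∉U , y-z)))

    μG≤eG+1 : μG U ≤ eG U + 1
    μG≤eG+1 = begin
      μG U
        ≡⟨ μG≡∑𝟙 ⟩
      ∑[ r < n ] 𝟙 (representative? r)
        ≡⟨ sum-cong-≗ (λ r → 𝟙-split (representative? r) (onBoundary? r)) ⟩
      ∑[ r < n ] (𝟙 (boundary? r) + 𝟙 (interior? r))
        ≡⟨ ∑-distrib-+ (λ r → 𝟙 (boundary? r)) (λ r → 𝟙 (interior? r)) ⟩
      ∑[ r < n ] 𝟙 (boundary? r) + ∑[ r < n ] 𝟙 (interior? r)
        ≤⟨ +-mono-≤ (sum-mono-≤ λ r → 𝟙≤∑𝟙 (boundary? r) (crossing? r) proj₂)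
                    (∑𝟙-unique interior? λ _ _ (rep , r-int) (rep′ , r′-int) →
                       representative-unique rep rep′ (interior-similar (proj₁ rep) (proj₁ rep′) r-int r′-int)) ⟩
      ∑[ x < n ] ∑[ y < n ] 𝟙 (crossing? x y) + 1
        ≡⟨ cong (_+ 1) (sym eG≡∑∑𝟙) ⟩
      eG U + 1 ∎
      where
      open ≤-Reasoning
      boundary? : ∀ r → Dec (Representative r × OnBoundary r)
      boundary? r = representative? r ×-dec onBoundary? r
      interior? : ∀ r → Dec (Representative r × ¬ OnBoundary r)
      interior? r = representative? r ×-dec ¬? (onBoundary? r)

    Represents : Fin n → Fin n → Set
    Represents r x = Representative r × Similar U r x × OnBoundary x

    represents? : ∀ r x → Dec (Represents r x)
    represents? r x = representative? r ×-dec similar? U r x ×-dec onBoundary? x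

    boundary-represented : ∀ x → OnBoundary x → ∃ λ r → Represents r x
    boundary-represented x x-boundary@(_ , x∈U , _) with r , rep , r~x ← representative-of x x∈U =
      r , rep , r~x , x-boundary

    module _ {Δ} (degree≤Δ : ∀ z → degree z ≤ Δ) where

      crossings-≤ : ∀ x → ∑[ y < n ] 𝟙 (crossing? x y) ≤ Δ * 𝟙 (onBoundary? x)
      crossings-≤ x = ∑𝟙≤*𝟙 (crossing? x) (onBoundary? x) (λ y x-y → y , x-y) λ _ _ →
        ≤-trans (sum-mono-≤ λ y → 𝟙-mono (crossing? x y) (adj? x y) (proj₂ ∘ proj₂)) (degree≤Δ x)

      class-≤ : ∀ r → ∑[ x < n ] 𝟙 (represents? r x) ≤ Δ * 𝟙 (representative? r)
      class-≤ r = ∑𝟙≤*𝟙 (represents? r) (representative? r) (λ _ → proj₁) bound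
        where
        bound : ∀ x → Represents r x → ∑[ y < n ] 𝟙 (represents? r y) ≤ Δ
        bound x (_ , r~x , z , _ , z∉U , x-z) =
          ≤-trans (sum-mono-≤ λ y → 𝟙-mono (represents? r y) (adj? z y)
                     λ (_ , r~y , _) → adj-sym (proj₁ (r~y z z∉U) (proj₂ (r~x z z∉U) x-z)))
                  (degree≤Δ z)

      eG≤Δ*Δ*μG : eG U ≤ Δ * Δ * μG U
      eG≤Δ*Δ*μG = begin
        eG U
          ≡⟨ eG≡∑∑𝟙 ⟩
        ∑[ x < n ] ∑[ y < n ] 𝟙 (crossing? x y)
          ≤⟨ sum-mono-≤ crossings-≤ ⟩
        ∑[ x < n ] (Δ * 𝟙 (onBoundary? x))
          ≤⟨ sum-mono-≤ (λ x → *-monoʳ-≤ Δ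
               (𝟙≤∑𝟙 (onBoundary? x) (λ r → represents? r x) (boundary-represented x))) ⟩
        ∑[ x < n ] (Δ * ∑[ r < n ] 𝟙 (represents? r x))
          ≡⟨ sym (*-distribˡ-sum Δ (λ x → ∑[ r < n ] 𝟙 (represents? r x))) ⟩
        Δ * ∑[ x < n ] ∑[ r < n ] 𝟙 (represents? r x)
          ≡⟨ cong (Δ *_) (∑-comm (λ x r → 𝟙 (represents? r x))) ⟩
        Δ * ∑[ r < n ] ∑[ x < n ] 𝟙 (represents? r x)
          ≤⟨ *-monoʳ-≤ Δ (sum-mono-≤ class-≤) ⟩
        Δ * ∑[ r < n ] (Δ * 𝟙 (representative? r))
          ≡⟨ cong (Δ *_) (sym (*-distribˡ-sum Δ (λ r → 𝟙 (representative? r)))) ⟩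
        Δ * (Δ * ∑[ r < n ] 𝟙 (representative? r))
          ≡⟨ sym (*-assoc Δ Δ _) ⟩
        Δ * Δ * ∑[ r < n ] 𝟙 (representative? r)
          ≡⟨ cong (Δ * Δ *_) (sym μG≡∑𝟙) ⟩
        Δ * Δ * μG U ∎
        where open ≤-Reasoning

lemma13 : (n : ℕ) → 1 ≤ n →
          (T₂ : RootedTree n) → IsBalanced 2 T₂ →
          (T₃ : RootedTree n) → IsBalanced 3 T₃ →
          (φ : Permutation′ n) → (U : Subset n) →
          Graph.eG T₂ T₃ φ U ≤ 49 * Graph.μG T₂ T₃ φ U
            × Graph.μG T₂ T₃ φ U ≤ Graph.eG T₂ T₃ φ U + 1
lemma13 n _ T₂ balanced₂ T₃ balanced₃ φ U =
  eG≤Δ*Δ*μG T₂ T₃ φ U (degree-≤ T₂ T₃ φ (IsBalanced.b-ary balanced₂) (IsBalanced.b-ary balanced₃)) ,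
  μG≤eG+1 T₂ T₃ φ U
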